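{- Let $s>6$ be a square-free integer with $\gcd(s,6)=1$ and $s\equiv 1\pmod 4$, and let $K=\mathbb{Q}(\sqrt{6},\sqrt{s})$. Then $\mathcal{P}(\mathcal{O}_K)\geq 6$. In particular, the element $$\alpha = 1^2+1^2+1^2+(1+\sqrt{6})^2+\left(\frac{1+\sqrt{s}}{2}\right)^2+\left(1+\frac{1+\sqrt{s}}{2}\right)^2\in\mathcal{O}_K$$ has length $\ell(\alpha)=6$.
   Context: For a commutative ring $R$, the length $\ell(\alpha)$ of a sum of squares $\alpha$ is the minimal number of squares of elements of $R$ summing to $\alpha$, and the Pythagoras number $\mathcal{P}(R)$ is the supremum of lengths of all finite sums of squares in $R$. $\mathcal{O}_K$ is the ring of integers of $K$. -}

module Defs where

open import Data.Nat as ℕ using (ℕ)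
open import Data.Nat.Divisibility using (_∣_)
open import Data.Nat.GCD using (gcd)
open import Data.Nat.DivMod using (_%_; _/_)
open import Data.Integer using (ℤ; +_; -[1+_]) renaming (_+_ to _+ℤ_; _*_ to _*ℤ_)
open import Data.Vec using (Vec; []; _∷_)
open import Data.Product using (Σ; ∃; _×_)
open import Relation.Binary.PropositionalEquality using (_≡_)
open import Relation.Nullary using (¬_)

SquareFree : ℕ → Set
SquareFree s = ∀ (p : ℕ) → (p ℕ.* p) ∣ s → p ≡ 1

record Admissible (s : ℕ) : Set where
  field
    s>6      : 6 ℕ.< s
    sqfree   : SquareFree s
    coprime6 : gcd s 6 ≡ 1
    mod4     : s % 4 ≡ 1

-- Since disc Q(√6) = 24 and
-- disc Q(√s) = s are coprime, O_K = Z[√6] ⊗ Z[ω] with ω = (1 + √s)/2, so O_K has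
-- Z-basis 1, √6, ω, √6·ω.  The element ⟨ a , b , c , d ⟩ represents
--   a + b√6 + c ω + d √6 ω .
-- ω satisfies ω² = ω + t where t = (s - 1)/4 (= s / 4 since s ≡ 1 mod 4).
record OK : Set where
  constructor ⟨_,_,_,_⟩
  field
    a b c d : ℤ

module Arith (s : ℕ) where
  t : ℤ
  t = + (s / 4)

  _+K_ : OK → OK → OK
  ⟨ a , b , c , d ⟩ +K ⟨ a' , b' , c' , d' ⟩ =
    ⟨ a +ℤ a' , b +ℤ b' , c +ℤ c' , d +ℤ d' ⟩

  -- (x + yω)(x' + y'ω) = (x x' + t y y') + (x y' + y x' + y y') ω,
  -- with x = a + b√6, y = c + d√6 etc., and (p + q√6)(p' + q'√6) = (pp' + 6qq') + (pq' + qp')√6.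
  _*K_ : OK → OK → OK
  ⟨ a , b , c , d ⟩ *K ⟨ a' , b' , c' , d' ⟩ =
    let
        xx₁ = a *ℤ a' +ℤ + 6 *ℤ (b *ℤ b')
        xx₂ = a *ℤ b' +ℤ b *ℤ a'
        yy₁ = c *ℤ c' +ℤ + 6 *ℤ (d *ℤ d')
        yy₂ = c *ℤ d' +ℤ d *ℤ c'
        xy₁ = a *ℤ c' +ℤ + 6 *ℤ (b *ℤ d')
        xy₂ = a *ℤ d' +ℤ b *ℤ c'
        yx₁ = c *ℤ a' +ℤ + 6 *ℤ (d *ℤ b')
        yx₂ = c *ℤ b' +ℤ d *ℤ a'
    in ⟨ xx₁ +ℤ t *ℤ yy₁ , xx₂ +ℤ t *ℤ yy₂
       , xy₁ +ℤ yx₁ +ℤ yy₁ , xy₂ +ℤ yx₂ +ℤ yy₂ ⟩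

  0K : OK
  0K = ⟨ + 0 , + 0 , + 0 , + 0 ⟩

  sq : OK → OK
  sq x = x *K x

  sumSq : ∀ {n} → Vec OK n → OK
  sumSq []       = 0K
  sumSq (x ∷ xs) = sq x +K sumSq xs

  SumOfSquares : ℕ → OK → Set
  SumOfSquares n α = Σ (Vec OK n) (λ v → sumSq v ≡ α)

  HasLength : OK → ℕ → Set
  HasLength α n = SumOfSquares n α × (∀ k → k ℕ.< n → ¬ SumOfSquares k α)

  PythagorasAtLeast : ℕ → Set
  PythagorasAtLeast n =
    ∃ λ β → (∃ λ m → SumOfSquares m β) × (∀ k → k ℕ.< n → ¬ SumOfSquares k β)

  one √6 ω : OK
  one = ⟨ + 1 , + 0 , + 0 , + 0 ⟩
  √6  = ⟨ + 0 , + 1 , + 0 , + 0 ⟩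
  ω   = ⟨ + 0 , + 0 , + 1 , + 0 ⟩

  α : OK
  α = sumSq (one ∷ one ∷ one ∷ (one +K √6) ∷ ω ∷ (one +K ω) ∷ [])

-- Write the summands as x = a + b√6 + (c + d√6)ω with ω² = ω + t, t = (s - 1)/4.  The
-- 1-coordinate of Σ x² is Σa² + 6Σb² + t(Σc² + 6Σd²), which for α equals 11 + 2t.  Since
-- t ≥ 3 (s = 9 is not square-free), comparing all four coordinates forces the d-column to
-- vanish and the columns a, b, c to have Gram matrix [[5,1,1],[1,1,0],[1,0,2]].  The
-- rows (a, b, c) of such a decomposition satisfy |a| ≤ 2 and |b|, |c| ≤ 1, so whether
-- this ternary form is a sum of fewer than six squares of integral linear forms is a
-- finite question, settled by a search that removes one row at a time and discards Gram
-- data taking a negative value on some small vector.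
module Submission where

import Data.Integer.Properties as ℤP
import Data.Nat.Properties as ℕP
open import Algebra.Properties.AbelianGroup ℤP.+-0-abelianGroup using (∙-cancelʳ)
open import Data.Bool using (Bool; true; false; _∧_; T)
open import Data.Bool.ListAction using (all; any)
open import Data.Bool.Properties using (T-∧)
open import Data.Integer as ℤ using (ℤ; +_; -[1+_]; 0ℤ; 1ℤ; ∣_∣; _+_; _*_; _-_; _≤?_)
open import Data.Integer.Tactic.RingSolver using (solve-∀)
open import Data.List using (List; []; _∷_; cartesianProduct; filterᵇ)
open import Data.List.Membership.Propositional using (_∈_)
open import Data.List.Membership.Propositional.Properties using (∈-cartesianProduct⁺)
open import Data.List.Relation.Unary.All as ListAll using (all?)
open import Data.List.Relation.Unary.Any as ListAny using (Any; here; there; any?)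
open import Data.List.Relation.Unary.All.Properties using (all⁻)
open import Data.List.Relation.Unary.Any.Properties using (any⁺)
open import Data.Nat as ℕ using (ℕ; zero; suc; z≤n; s≤s; s≤s⁻¹; _<_; _≤_)
open import Data.Nat.DivMod using (_/_; m≡m%n+[m/n]*n)
open import Data.Nat.Divisibility using (divides)
open import Data.Product using (_×_; _,_)
open import Data.Sum using (inj₁; inj₂)
open import Data.Vec as Vec using (Vec; []; _∷_; map; zipWith; replicate)
open import Data.Vec.Properties using (≡-dec)
open import Data.Vec.Relation.Unary.All as All using (All; []; _∷_)
open import Data.Vec.Relation.Unary.All.Properties using (map⁻; map⁺)
open import Defs
open import Function using (_∘_; Equivalence)
open import Relation.Binary.PropositionalEquality
open import Relation.Nullary using (¬_; contradiction)
open import Relation.Nullary.Decidable using (⌊_⌋; fromWitness; from-yes)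

∣_∣² : ℤ → ℕ
∣ i ∣² = ∣ i ∣ ℕ.* ∣ i ∣

i*i≡+∣i∣² : ∀ i → i * i ≡ + ∣ i ∣²
i*i≡+∣i∣² (+ n)    = ℤP.+◃n≡+n (n ℕ.* n)
i*i≡+∣i∣² -[1+ n ] = ℤP.+◃n≡+n _

0≤i*i : ∀ i → 0ℤ ℤ.≤ i * i
0≤i*i i = subst (0ℤ ℤ.≤_) (sym (i*i≡+∣i∣² i)) (ℤ.+≤+ z≤n)

∣i∣²≡0⇒i≡0 : ∀ {i} → ∣ i ∣² ≡ 0 → i ≡ 0ℤ
∣i∣²≡0⇒i≡0 {+ zero}   _  = refl
∣i∣²≡0⇒i≡0 {+ suc _}  ()
∣i∣²≡0⇒i≡0 { -[1+ _ ]} ()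

m*m<n*n⇒m<n : ∀ {m n} → m ℕ.* m < n ℕ.* n → m < n
m*m<n*n⇒m<n {m} {n} m²<n² = ℕP.≰⇒> λ n≤m → ℕP.<⇒≱ m²<n² (ℕP.*-mono-≤ n≤m n≤m)

infix 8 _·_

_·_ : ∀ {n} → Vec ℤ n → Vec ℤ n → ℤ
[]      · []      = 0ℤ
(x ∷ u) · (y ∷ v) = x * y + u · v

‖_‖² : ∀ {n} → Vec ℤ n → ℕ
‖ u ‖² = Vec.sum (map ∣_∣² u)

·-distribˡ-+ : ∀ {n} (u v w : Vec ℤ n) → u · zipWith _+_ v w ≡ u · v + u · w
·-distribˡ-+ []      []      []      = refl
·-distribˡ-+ (x ∷ u) (y ∷ v) (z ∷ w) = begin
  x * (y + z) + u · zipWith _+_ v w  ≡⟨ cong (_+_ (x * (y + z))) (·-distribˡ-+ u v w) ⟩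
  x * (y + z) + (u · v + u · w)      ≡⟨ rearrange x y z (u · v) (u · w) ⟩
  (x * y + u · v) + (x * z + u · w)  ∎
  where
  open ≡-Reasoning
  rearrange : ∀ x y z p q → x * (y + z) + (p + q) ≡ (x * y + p) + (x * z + q)
  rearrange = solve-∀

·-zeroʳ : ∀ {n} (u : Vec ℤ n) → u · replicate n 0ℤ ≡ 0ℤ
·-zeroʳ []      = refl
·-zeroʳ (x ∷ u) = cong₂ _+_ (ℤP.*-zeroʳ x) (·-zeroʳ u)

zipWith-+-cancelˡ : ∀ {n} (u v : Vec ℤ n) → zipWith _-_ (zipWith _+_ u v) u ≡ v
zipWith-+-cancelˡ []      []      = refl
zipWith-+-cancelˡ (x ∷ u) (y ∷ v) = cong₂ _∷_ (cancel x y) (zipWith-+-cancelˡ u v)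
  where
  cancel : ∀ x y → x + y - x ≡ y
  cancel = solve-∀

·-self : ∀ {n} (u : Vec ℤ n) → u · u ≡ + ‖ u ‖²
·-self []      = refl
·-self (x ∷ u) = trans (cong₂ _+_ (i*i≡+∣i∣² x) (·-self u)) (sym (ℤP.pos-+ ∣ x ∣² ‖ u ‖²))

‖‖²≡0⇒·≡0 : ∀ {n} (w u : Vec ℤ n) → ‖ u ‖² ≡ 0 → w · u ≡ 0ℤ
‖‖²≡0⇒·≡0 []      []      _ = refl
‖‖²≡0⇒·≡0 (y ∷ w) (x ∷ u) e
  rewrite ∣i∣²≡0⇒i≡0 {x} (ℕP.m+n≡0⇒m≡0 ∣ x ∣² e)
        | ‖‖²≡0⇒·≡0 w u (ℕP.m+n≡0⇒n≡0 ∣ x ∣² e) = cong (_+ 0ℤ) (ℤP.*-zeroʳ y)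

∣∣²≤‖‖² : ∀ {n} (u : Vec ℤ n) → All (λ x → ∣ x ∣² ≤ ‖ u ‖²) u
∣∣²≤‖‖² []      = []
∣∣²≤‖‖² (x ∷ u) = ℕP.m≤m+n ∣ x ∣² ‖ u ‖²
                ∷ All.map (λ le → ℕP.≤-trans le (ℕP.m≤n+m ‖ u ‖² ∣ x ∣²)) (∣∣²≤‖‖² u)

Row : Set
Row = ℤ × ℤ × ℤ

-- The square (a x + b y + c z)² of a linear form, stored as the entries
-- (a², b², c², ab, ac, bc) of its Gram matrix.
gram : Row → Vec ℤ 6
gram (a , b , c) = a * a ∷ b * b ∷ c * c ∷ a * b ∷ a * c ∷ b * c ∷ []

gramSum : ∀ {n} → Vec Row n → Vec ℤ 6
gramSum []       = replicate 6 0ℤ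
gramSum (r ∷ rs) = zipWith _+_ (gram r) (gramSum rs)

linear : Row → Row → ℤ
linear (a , b , c) (x , y , z) = a * x + b * y + c * z

monomials : Row → Vec ℤ 6
monomials (x , y , z) = x * x ∷ y * y ∷ z * z ∷ + 2 * (x * y) ∷ + 2 * (x * z) ∷ + 2 * (y * z) ∷ []

quadForm : Vec ℤ 6 → Row → ℤ
quadForm G f = monomials f · G

quadForm-gram : ∀ r f → quadForm (gram r) f ≡ linear r f * linear r f
quadForm-gram (a , b , c) (x , y , z) = square a b c x y z
  where
  square : ∀ a b c x y z →
    x * x * (a * a) + (y * y * (b * b) + (z * z * (c * c) + (+ 2 * (x * y) * (a * b) +
      (+ 2 * (x * z) * (a * c) + (+ 2 * (y * z) * (b * c) + 0ℤ)))))
    ≡ (a * x + b * y + c * z) * (a * x + b * y + c * z)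
  square = solve-∀

quadForm-gramSum-nonneg : ∀ {n} (rs : Vec Row n) f → 0ℤ ℤ.≤ quadForm (gramSum rs) f
quadForm-gramSum-nonneg []       f = ℤP.≤-reflexive (sym (·-zeroʳ (monomials f)))
quadForm-gramSum-nonneg (r ∷ rs) f =
  subst (0ℤ ℤ.≤_) (sym (·-distribˡ-+ (monomials f) (gram r) (gramSum rs)))
    (ℤP.+-mono-≤ (subst (0ℤ ℤ.≤_) (sym (quadForm-gram r f)) (0≤i*i (linear r f)))
                 (quadForm-gramSum-nonneg rs f))

interval : ℕ → List ℤ
interval zero    = + 0 ∷ []
interval (suc n) = -[1+ n ] ∷ + suc n ∷ interval n

∈-interval : ∀ n i → ∣ i ∣ ≤ n → i ∈ interval n
∈-interval zero    (+ zero) _ = here refl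
∈-interval (suc n) i ∣i∣≤1+n with i | ℕP.m≤n⇒m<n∨m≡n ∣i∣≤1+n
... | j        | inj₁ ∣j∣<1+n = there (there (∈-interval n j (s≤s⁻¹ ∣j∣<1+n)))
... | + _      | inj₂ refl    = there (here refl)
... | -[1+ _ ] | inj₂ refl    = here refl

Bounded : Row → Set
Bounded (a , b , c) = ∣ a ∣ ≤ 2 × ∣ b ∣ ≤ 1 × ∣ c ∣ ≤ 1

boundedRows : List Row
boundedRows = cartesianProduct (interval 2) (cartesianProduct (interval 1) (interval 1))

bounded⇒∈boundedRows : ∀ r → Bounded r → r ∈ boundedRows
bounded⇒∈boundedRows (a , b , c) (∣a∣≤2 , ∣b∣≤1 , ∣c∣≤1) =
  ∈-cartesianProduct⁺ (∈-interval 2 a ∣a∣≤2)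
    (∈-cartesianProduct⁺ (∈-interval 1 b ∣b∣≤1) (∈-interval 1 c ∣c∣≤1))

leadingNonneg : Row → Bool
leadingNonneg (+ suc _ , _       , _  ) = true
leadingNonneg (+ zero  , + suc _ , _  ) = true
leadingNonneg (+ zero  , + zero  , + _) = true
leadingNonneg _                         = false

-- gram r ≡ gram (- r), so the search only needs one row of each pair ± r.
representatives : List Row
representatives = filterᵇ leadingNonneg boundedRows

representatives-cover : ListAll.All (λ r → Any (λ r′ → gram r′ ≡ gram r) representatives) boundedRows
representatives-cover =
  from-yes (all? (λ r → any? (λ r′ → ≡-dec ℤ._≟_ (gram r′) (gram r)) representatives) boundedRows)

testVectors : List Row
testVectors =
  filterᵇ leadingNonneg (cartesianProduct (interval 1) (cartesianProduct (interval 1) (interval 1)))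

nonnegAt : Vec ℤ 6 → Row → Bool
nonnegAt G f = ⌊ 0ℤ ≤? quadForm G f ⌋

_⊖_ : Vec ℤ 6 → Row → Vec ℤ 6
G ⊖ r = zipWith _-_ G (gram r)

decomposable : ℕ → Vec ℤ 6 → Bool
decomposable zero    G = ⌊ ≡-dec ℤ._≟_ G (replicate 6 0ℤ) ⌋
decomposable (suc k) G =
  all (nonnegAt G) testVectors ∧ any (λ r → decomposable k (G ⊖ r)) representatives

decomposable-complete : ∀ {n} (rs : Vec Row n) → All Bounded rs → T (decomposable n (gramSum rs))
decomposable-complete         []       []         = _
decomposable-complete {suc n} (r ∷ rs) (br ∷ brs) = Equivalence.from T-∧ (nonneg , removable)
  where
  G : Vec ℤ 6
  G = gramSum (r ∷ rs)

  nonneg : T (all (nonnegAt G) testVectors)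
  nonneg = all⁻ (nonnegAt G)
    (ListAll.universal (λ f → fromWitness (quadForm-gramSum-nonneg (r ∷ rs) f)) testVectors)

  remove : ∀ {r′} → gram r′ ≡ gram r → T (decomposable n (G ⊖ r′))
  remove e rewrite e | zipWith-+-cancelˡ (gram r) (gramSum rs) = decomposable-complete rs brs

  removable : T (any (λ r′ → decomposable n (G ⊖ r′)) representatives)
  removable = any⁺ (λ r′ → decomposable n (G ⊖ r′))
    (ListAny.map (λ {r′} → remove {r′})
      (ListAll.lookup representatives-cover (bounded⇒∈boundedRows r br)))

ternary : Vec ℤ 6
ternary = + 5 ∷ + 1 ∷ + 2 ∷ + 1 ∷ + 1 ∷ + 0 ∷ []

-- Each absurd pattern is the whole search, evaluated by the type checker to T false.
ternary-not-decomposable : ∀ k → k < 6 → ¬ T (decomposable k ternary)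
ternary-not-decomposable 0 _ ()
ternary-not-decomposable 1 _ ()
ternary-not-decomposable 2 _ ()
ternary-not-decomposable 3 _ ()
ternary-not-decomposable 4 _ ()
ternary-not-decomposable 5 _ ()
ternary-not-decomposable (suc (suc (suc (suc (suc (suc _)))))) (s≤s (s≤s (s≤s (s≤s (s≤s (s≤s ()))))))

11+q*2<q*6 : ∀ {q} → 3 ≤ q → 11 ℕ.+ q ℕ.* 2 < q ℕ.* 6
11+q*2<q*6 {q} 3≤q = begin
  12 ℕ.+ q ℕ.* 2    ≤⟨ ℕP.+-monoˡ-≤ (q ℕ.* 2) (ℕP.*-monoˡ-≤ 4 3≤q) ⟩
  q ℕ.* 4 ℕ.+ q ℕ.* 2 ≡⟨ ℕP.*-distribˡ-+ q 4 2 ⟨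
  q ℕ.* 6           ∎
  where open ℕP.≤-Reasoning

11+q*2<6+q*4 : ∀ {q} → 3 ≤ q → 11 ℕ.+ q ℕ.* 2 < 6 ℕ.+ q ℕ.* 4
11+q*2<6+q*4 {q} 3≤q = begin
  12 ℕ.+ q ℕ.* 2        ≤⟨ ℕP.+-monoʳ-≤ 6 (ℕP.+-monoˡ-≤ (q ℕ.* 2) (ℕP.*-monoˡ-≤ 2 3≤q)) ⟩
  6 ℕ.+ (q ℕ.* 2 ℕ.+ q ℕ.* 2) ≡⟨ cong (6 ℕ.+_) (ℕP.*-distribˡ-+ q 2 2) ⟨
  6 ℕ.+ q ℕ.* 4         ∎
  where open ℕP.≤-Reasoning

coord₁-equation⇒p₄≡0 : ∀ {q p₁ p₂ p₃ p₄} → 3 ≤ q →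
          p₁ ℕ.+ 6 ℕ.* p₂ ℕ.+ q ℕ.* (p₃ ℕ.+ 6 ℕ.* p₄) ≡ 11 ℕ.+ q ℕ.* 2 → p₄ ≡ 0
coord₁-equation⇒p₄≡0 {p₄ = zero} _ _ = refl
coord₁-equation⇒p₄≡0 {q} {p₁} {p₂} {p₃} {suc p₄} 3≤q e = contradiction (sym e) (ℕP.<⇒≢ (begin-strict
  11 ℕ.+ q ℕ.* 2                                <⟨ 11+q*2<q*6 3≤q ⟩
  q ℕ.* 6                                       ≤⟨ ℕP.*-monoʳ-≤ q six≤ ⟩
  q ℕ.* (p₃ ℕ.+ 6 ℕ.* suc p₄)                   ≤⟨ ℕP.m≤n+m _ (p₁ ℕ.+ 6 ℕ.* p₂) ⟩
  p₁ ℕ.+ 6 ℕ.* p₂ ℕ.+ q ℕ.* (p₃ ℕ.+ 6 ℕ.* suc p₄) ∎))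
  where
  open ℕP.≤-Reasoning
  six≤ : 6 ≤ p₃ ℕ.+ 6 ℕ.* suc p₄
  six≤ = ℕP.≤-trans (ℕP.m≤m*n 6 (suc p₄)) (ℕP.m≤n+m _ p₃)

diagonal-entries : ∀ {q p₁ p₂ m} → 3 ≤ q → p₁ ℕ.+ 6 ℕ.* p₂ ℕ.+ q ℕ.* (2 ℕ.* m) ≡ 11 ℕ.+ q ℕ.* 2 →
           p₂ ≢ 0 → m ≢ 0 → p₁ ≡ 5 × p₂ ≡ 1 × m ≡ 1
diagonal-entries {p₂ = zero} _ _ p₂≢0 _ = contradiction refl p₂≢0
diagonal-entries {m = zero}  _ _ _ m≢0  = contradiction refl m≢0
diagonal-entries {q} {p₁} {suc p₂} {suc (suc m)} 3≤q e _ _ = contradiction (sym e) (ℕP.<⇒≢ (begin-strict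
  11 ℕ.+ q ℕ.* 2                                     <⟨ 11+q*2<6+q*4 3≤q ⟩
  6 ℕ.+ q ℕ.* 4                                      ≤⟨ ℕP.+-mono-≤ (ℕP.m≤m*n 6 (suc p₂)) q*4≤ ⟩
  6 ℕ.* suc p₂ ℕ.+ q ℕ.* (2 ℕ.* suc (suc m))         ≤⟨ ℕP.+-monoˡ-≤ _ (ℕP.m≤n+m _ p₁) ⟩
  p₁ ℕ.+ 6 ℕ.* suc p₂ ℕ.+ q ℕ.* (2 ℕ.* suc (suc m)) ∎))
  where
  open ℕP.≤-Reasoning
  q*4≤ : q ℕ.* 4 ≤ q ℕ.* (2 ℕ.* suc (suc m))
  q*4≤ = ℕP.*-monoʳ-≤ q (ℕP.*-monoʳ-≤ 2 (s≤s (s≤s z≤n)))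
diagonal-entries {q} {p₁} {suc (suc p₂)} {1} _ e _ _ = contradiction (sym e′) (ℕP.<⇒≢ (begin-strict
  11                          <⟨ ℕP.n<1+n 11 ⟩
  12                          ≤⟨ ℕP.*-monoʳ-≤ 6 (s≤s (s≤s z≤n)) ⟩
  6 ℕ.* suc (suc p₂)          ≤⟨ ℕP.m≤n+m _ p₁ ⟩
  p₁ ℕ.+ 6 ℕ.* suc (suc p₂)   ∎))
  where
  open ℕP.≤-Reasoning
  e′ : p₁ ℕ.+ 6 ℕ.* suc (suc p₂) ≡ 11
  e′ = ℕP.+-cancelʳ-≡ (q ℕ.* 2) _ 11 e
diagonal-entries {q} {p₁} {1} {1} _ e _ _ =
  ℕP.+-cancelʳ-≡ 6 p₁ 5 (ℕP.+-cancelʳ-≡ (q ℕ.* 2) _ 11 e) , refl , refl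

2k+n≡4⇒n≡2∣2-k∣ : ∀ k n → + 2 * k + + n ≡ + 4 → n ≡ 2 ℕ.* ∣ + 2 - k ∣
2k+n≡4⇒n≡2∣2-k∣ k n e = begin
  n                       ≡⟨⟩
  ∣ + n ∣                 ≡⟨ cong ∣_∣ (isolate k (+ n)) ⟩
  ∣ + 2 * k + + n - + 2 * k ∣ ≡⟨ cong (λ z → ∣ z - + 2 * k ∣) e ⟩
  ∣ + 4 - + 2 * k ∣       ≡⟨ cong ∣_∣ (factor k) ⟩
  ∣ + 2 * (+ 2 - k) ∣     ≡⟨ ℤP.abs-* (+ 2) (+ 2 - k) ⟩
  2 ℕ.* ∣ + 2 - k ∣       ∎
  where
  open ≡-Reasoning
  isolate : ∀ k n → n ≡ + 2 * k + n - + 2 * k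
  isolate = solve-∀
  factor : ∀ k → + 4 - + 2 * k ≡ + 2 * (+ 2 - k)
  factor = solve-∀

solve-reduced-equations : ∀ {q p₁ p₂ p₃} {ab ac : ℤ} → 3 ≤ q →
             p₁ ℕ.+ 6 ℕ.* p₂ ℕ.+ q ℕ.* p₃ ≡ 11 ℕ.+ q ℕ.* 2 →
             ab ≡ 1ℤ → (p₂ ≡ 0 → ab ≡ 0ℤ) →
             + 2 * ac + + p₃ ≡ + 4 → (p₃ ≡ 0 → ac ≡ 0ℤ) →
             p₁ ≡ 5 × p₂ ≡ 1 × p₃ ≡ 2 × ac ≡ 1ℤ
solve-reduced-equations {q} {p₁} {p₂} {p₃} {ab} {ac} 3≤q e₁ ab≡1 ab≡0 e₃ ac≡0 =
  let p₁≡5 , p₂≡1 , m≡1 = diagonal-entries 3≤q e₁′ p₂≢0 m≢0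
      p₃≡2 = trans p₃≡2m (cong (2 ℕ.*_) m≡1)
  in  p₁≡5 , p₂≡1 , p₃≡2 , ac≡1 p₃≡2
  where
  m : ℕ
  m = ∣ + 2 - ac ∣

  p₃≡2m : p₃ ≡ 2 ℕ.* m
  p₃≡2m = 2k+n≡4⇒n≡2∣2-k∣ ac p₃ e₃

  e₁′ : p₁ ℕ.+ 6 ℕ.* p₂ ℕ.+ q ℕ.* (2 ℕ.* m) ≡ 11 ℕ.+ q ℕ.* 2
  e₁′ = subst (λ z → p₁ ℕ.+ 6 ℕ.* p₂ ℕ.+ q ℕ.* z ≡ 11 ℕ.+ q ℕ.* 2) p₃≡2m e₁

  p₂≢0 : p₂ ≢ 0
  p₂≢0 p₂≡0 = contradiction (trans (sym ab≡1) (ab≡0 p₂≡0)) λ ()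

  m≢0 : m ≢ 0
  m≢0 m≡0 = contradiction (trans (sym e₃) (cong₂ (λ x y → + 2 * x + + y) (ac≡0 p₃≡0) p₃≡0)) λ ()
    where
    p₃≡0 : p₃ ≡ 0
    p₃≡0 = trans p₃≡2m (cong (2 ℕ.*_) m≡0)

  ac≡1 : p₃ ≡ 2 → ac ≡ 1ℤ
  ac≡1 p₃≡2 = ℤP.*-cancelˡ-≡ (+ 2) ac 1ℤ
    (∙-cancelʳ (+ 2) _ _ (subst (λ z → + 2 * ac + + z ≡ + 4) p₃≡2 e₃))

admissible⇒3≤s/4 : ∀ {s} → Admissible s → 3 ≤ s / 4
admissible⇒3≤s/4 {s} adm =
  s≡1+q*4⇒3≤q (s / 4) (trans (m≡m%n+[m/n]*n s 4) (cong (ℕ._+ s / 4 ℕ.* 4) (Admissible.mod4 adm)))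
  where
  s≡1+q*4⇒3≤q : ∀ q → s ≡ 1 ℕ.+ q ℕ.* 4 → 3 ≤ q
  s≡1+q*4⇒3≤q 0 refl = contradiction (Admissible.s>6 adm) λ { (s≤s ()) }
  s≡1+q*4⇒3≤q 1 refl = contradiction (Admissible.s>6 adm) λ { (s≤s (s≤s (s≤s (s≤s (s≤s ()))))) }
  s≡1+q*4⇒3≤q 2 s≡9  = contradiction (Admissible.sqfree adm 3 (divides 1 s≡9)) λ ()
  s≡1+q*4⇒3≤q (suc (suc (suc q))) _ = s≤s (s≤s (s≤s z≤n))

pos-linear : ∀ p₁ p₂ p₃ p₄ q → + (p₁ ℕ.+ 6 ℕ.* p₂ ℕ.+ q ℕ.* (p₃ ℕ.+ 6 ℕ.* p₄))
                                ≡ + p₁ + + 6 * + p₂ + + q * (+ p₃ + + 6 * + p₄)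
pos-linear p₁ p₂ p₃ p₄ q =
  cong₂ (λ x y → + p₁ + x + y) (ℤP.pos-* 6 p₂)
        (trans (ℤP.pos-* q (p₃ ℕ.+ 6 ℕ.* p₄)) (cong (λ z → + q * (+ p₃ + z)) (ℤP.pos-* 6 p₄)))

OK-≡ : ∀ {x₁ x₂ x₃ x₄ y₁ y₂ y₃ y₄} → x₁ ≡ y₁ → x₂ ≡ y₂ → x₃ ≡ y₃ → x₄ ≡ y₄ →
       ⟨ x₁ , x₂ , x₃ , x₄ ⟩ ≡ ⟨ y₁ , y₂ , y₃ , y₄ ⟩
OK-≡ refl refl refl refl = refl

row : OK → Row
row x = OK.a x , OK.b x , OK.c x

TernaryColumns : ∀ {n} → Vec OK n → Set
TernaryColumns v = ‖ A ‖² ≡ 5 × ‖ B ‖² ≡ 1 × ‖ C ‖² ≡ 2 × A · B ≡ 1ℤ × A · C ≡ 1ℤ × B · C ≡ 0ℤ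
  where
  A B C : Vec ℤ _
  A = map OK.a v
  B = map OK.b v
  C = map OK.c v

gramSum-map-row : ∀ {n} (v : Vec OK n) → gramSum (map row v) ≡
  (map OK.a v · map OK.a v ∷ map OK.b v · map OK.b v ∷ map OK.c v · map OK.c v ∷
   map OK.a v · map OK.b v ∷ map OK.a v · map OK.c v ∷ map OK.b v · map OK.c v ∷ [])
gramSum-map-row []      = refl
gramSum-map-row (x ∷ v) = cong (zipWith _+_ (gram (row x))) (gramSum-map-row v)

TernaryColumns⇒gramSum≡ternary : ∀ {n} (v : Vec OK n) → TernaryColumns v →
                                 gramSum (map row v) ≡ ternary
TernaryColumns⇒gramSum≡ternary v (e₁ , e₂ , e₃ , e₁₂ , e₁₃ , e₂₃)
  rewrite gramSum-map-row v | ·-self (map OK.a v) | ·-self (map OK.b v) | ·-self (map OK.c v)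
        | e₁ | e₂ | e₃ | e₁₂ | e₁₃ | e₂₃ = refl

column-bound : ∀ {X : Set} (f : X → ℤ) {n} (v : Vec X n) {k} →
               ‖ map f v ‖² < suc k ℕ.* suc k → All (λ x → ∣ f x ∣ ≤ k) v
column-bound f v ‖‖²<k² =
  map⁻ (All.map (λ {i} le → s≤s⁻¹ (m*m<n*n⇒m<n {∣ i ∣} (ℕP.≤-<-trans le ‖‖²<k²))) (∣∣²≤‖‖² (map f v)))

TernaryColumns⇒bounded : ∀ {n} (v : Vec OK n) → TernaryColumns v → All Bounded (map row v)
TernaryColumns⇒bounded v (e₁ , e₂ , e₃ , _) = map⁺ (All.zip
  ( column-bound OK.a v (subst (_< 9) (sym e₁) (from-yes (5 ℕ.<? 9)))
  , All.zip ( column-bound OK.b v (subst (_< 4) (sym e₂) (from-yes (1 ℕ.<? 4)))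
            , column-bound OK.c v (subst (_< 4) (sym e₃) (from-yes (2 ℕ.<? 4))))))

module _ (s : ℕ) where
  open Arith s
  open OK using (a; b; c; d)

  expandSumSq : ∀ {n} → Vec OK n → OK
  expandSumSq v =
    ⟨ A · A + + 6 * (B · B) + t * (C · C + + 6 * (D · D))
    , + 2 * (A · B + t * (C · D))
    , + 2 * (A · C) + + 12 * (B · D) + C · C + + 6 * (D · D)
    , + 2 * (A · D + B · C + C · D)
    ⟩
    where
    A B C D : Vec ℤ _
    A = map a v
    B = map b v
    C = map c v
    D = map d v

  sq+K-expandSumSq : ∀ {n} x (v : Vec OK n) → sq x +K expandSumSq v ≡ expandSumSq (x ∷ v)
  sq+K-expandSumSq ⟨ x₁ , x₂ , x₃ , x₄ ⟩ v =
    OK-≡ (coord₁ x₁ x₂ x₃ x₄ t _ _ _ _) (coord₂ x₁ x₂ x₃ x₄ t _ _)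
         (coord₃ x₁ x₂ x₃ x₄ _ _ _ _) (coord₄ x₁ x₂ x₃ x₄ _ _ _)
    where
    coord₁ : ∀ x₁ x₂ x₃ x₄ t P Q R S →
      x₁ * x₁ + + 6 * (x₂ * x₂) + t * (x₃ * x₃ + + 6 * (x₄ * x₄)) + (P + + 6 * Q + t * (R + + 6 * S))
      ≡ x₁ * x₁ + P + + 6 * (x₂ * x₂ + Q) + t * (x₃ * x₃ + R + + 6 * (x₄ * x₄ + S))
    coord₁ = solve-∀
    coord₂ : ∀ x₁ x₂ x₃ x₄ t P Q →
      x₁ * x₂ + x₂ * x₁ + t * (x₃ * x₄ + x₄ * x₃) + + 2 * (P + t * Q)
      ≡ + 2 * (x₁ * x₂ + P + t * (x₃ * x₄ + Q))
    coord₂ = solve-∀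
    coord₃ : ∀ x₁ x₂ x₃ x₄ P Q R S →
      x₁ * x₃ + + 6 * (x₂ * x₄) + (x₃ * x₁ + + 6 * (x₄ * x₂)) + (x₃ * x₃ + + 6 * (x₄ * x₄))
        + (+ 2 * P + + 12 * Q + R + + 6 * S)
      ≡ + 2 * (x₁ * x₃ + P) + + 12 * (x₂ * x₄ + Q) + (x₃ * x₃ + R) + + 6 * (x₄ * x₄ + S)
    coord₃ = solve-∀
    coord₄ : ∀ x₁ x₂ x₃ x₄ P Q R →
      x₁ * x₄ + x₂ * x₃ + (x₃ * x₂ + x₄ * x₁) + (x₃ * x₄ + x₄ * x₃) + + 2 * (P + Q + R)
      ≡ + 2 * (x₁ * x₄ + P + (x₂ * x₃ + Q) + (x₃ * x₄ + R))
    coord₄ = solve-∀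

  sumSq≡expandSumSq : ∀ {n} (v : Vec OK n) → sumSq v ≡ expandSumSq v
  sumSq≡expandSumSq []      =
    cong (λ z → ⟨ + 0 + z , + 2 * (+ 0 + z) , + 0 , + 0 ⟩) (sym (ℤP.*-zeroʳ t))
  sumSq≡expandSumSq (x ∷ v) = trans (cong (sq x +K_) (sumSq≡expandSumSq v)) (sq+K-expandSumSq x v)

  α-summands : Vec OK 6
  α-summands = one ∷ one ∷ one ∷ (one +K √6) ∷ ω ∷ (one +K ω) ∷ []

  coord₁-expandSumSq : ∀ {n} (v : Vec OK n) → OK.a (expandSumSq v) ≡
    + (‖ map a v ‖² ℕ.+ 6 ℕ.* ‖ map b v ‖² ℕ.+ s / 4 ℕ.* (‖ map c v ‖² ℕ.+ 6 ℕ.* ‖ map d v ‖²))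
  coord₁-expandSumSq v
    rewrite ·-self (map a v) | ·-self (map b v) | ·-self (map c v) | ·-self (map d v) =
    sym (pos-linear ‖ map a v ‖² ‖ map b v ‖² ‖ map c v ‖² ‖ map d v ‖² (s / 4))

  module _ (3≤s/4 : 3 ≤ s / 4) {n} {v : Vec OK n} (v²≡α : sumSq v ≡ α) where
    private
      A B C D : Vec ℤ n
      A = map a v
      B = map b v
      C = map c v
      D = map d v

    coordinates : expandSumSq v ≡ expandSumSq α-summands
    coordinates = trans (sym (sumSq≡expandSumSq v)) (trans v²≡α (sumSq≡expandSumSq α-summands))

    coord₁-equation :
      ‖ A ‖² ℕ.+ 6 ℕ.* ‖ B ‖² ℕ.+ s / 4 ℕ.* (‖ C ‖² ℕ.+ 6 ℕ.* ‖ D ‖²) ≡ 11 ℕ.+ s / 4 ℕ.* 2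
    coord₁-equation = ℤP.+-injective
      (trans (sym (coord₁-expandSumSq v)) (trans (cong OK.a coordinates) (coord₁-expandSumSq α-summands)))

    ‖D‖²≡0 : ‖ D ‖² ≡ 0
    ‖D‖²≡0 = coord₁-equation⇒p₄≡0 {p₁ = ‖ A ‖²} {‖ B ‖²} {‖ C ‖²} 3≤s/4 coord₁-equation

    ·D≡0 : ∀ u → u · D ≡ 0ℤ
    ·D≡0 u = ‖‖²≡0⇒·≡0 u D ‖D‖²≡0

    coord₁-reduced : ‖ A ‖² ℕ.+ 6 ℕ.* ‖ B ‖² ℕ.+ s / 4 ℕ.* ‖ C ‖² ≡ 11 ℕ.+ s / 4 ℕ.* 2
    coord₁-reduced = subst (λ z → ‖ A ‖² ℕ.+ 6 ℕ.* ‖ B ‖² ℕ.+ s / 4 ℕ.* z ≡ 11 ℕ.+ s / 4 ℕ.* 2)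
                           C+6D≡C coord₁-equation
      where
      C+6D≡C : ‖ C ‖² ℕ.+ 6 ℕ.* ‖ D ‖² ≡ ‖ C ‖²
      C+6D≡C rewrite ‖D‖²≡0 = ℕP.+-identityʳ ‖ C ‖²

    A·B≡1 : A · B ≡ 1ℤ
    A·B≡1 = ∙-cancelʳ (t * 0ℤ) (A · B) 1ℤ (ℤP.*-cancelˡ-≡ (+ 2) _ _
      (subst (λ z → + 2 * (A · B + t * z) ≡ + 2 * (1ℤ + t * 0ℤ)) (·D≡0 C) (cong OK.b coordinates)))

    coord₃-reduced : + 2 * (A · C) + + ‖ C ‖² ≡ + 4
    coord₃-reduced = begin
      + 2 * (A · C) + + ‖ C ‖²
        ≡⟨ cong (_+_ (+ 2 * (A · C))) (·-self C) ⟨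
      + 2 * (A · C) + C · C
        ≡⟨ dropZeros (+ 2 * (A · C)) (C · C) (·D≡0 B) (·D≡0 D) ⟨
      + 2 * (A · C) + + 12 * (B · D) + C · C + + 6 * (D · D)
        ≡⟨ cong OK.c coordinates ⟩
      + 4
        ∎
      where
      open ≡-Reasoning
      dropZeros : ∀ x y {z w} → z ≡ 0ℤ → w ≡ 0ℤ → x + + 12 * z + y + + 6 * w ≡ x + y
      dropZeros x y refl refl = identity x y
        where
        identity : ∀ x y → x + + 12 * 0ℤ + y + + 6 * 0ℤ ≡ x + y
        identity = solve-∀

    B·C≡0 : B · C ≡ 0ℤ
    B·C≡0 = begin
      B · C              ≡⟨ identity (B · C) ⟨
      0ℤ + B · C + 0ℤ    ≡⟨ ℤP.*-cancelˡ-≡ (+ 2) _ 0ℤ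
                              (subst₂ (λ x y → + 2 * (x + B · C + y) ≡ 0ℤ) (·D≡0 A) (·D≡0 C)
                                      (cong OK.d coordinates)) ⟩
      0ℤ                 ∎
      where
      open ≡-Reasoning
      identity : ∀ x → 0ℤ + x + 0ℤ ≡ x
      identity = solve-∀

    ternaryColumns : TernaryColumns v
    ternaryColumns =
      let ‖A‖²≡5 , ‖B‖²≡1 , ‖C‖²≡2 , A·C≡1 =
            solve-reduced-equations 3≤s/4 coord₁-reduced A·B≡1 (‖‖²≡0⇒·≡0 A B)
                                    coord₃-reduced (‖‖²≡0⇒·≡0 A C)
      in  ‖A‖²≡5 , ‖B‖²≡1 , ‖C‖²≡2 , A·B≡1 , A·C≡1 , B·C≡0

  α-sum-of-six-squares : SumOfSquares 6 α
  α-sum-of-six-squares = α-summands , refl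

  α-not-sum-of-fewer-squares : Admissible s → ∀ k → k < 6 → ¬ SumOfSquares k α
  α-not-sum-of-fewer-squares adm k k<6 (v , v²≡α) =
    ternary-not-decomposable k k<6
      (subst (T ∘ decomposable k) (TernaryColumns⇒gramSum≡ternary v columns)
             (decomposable-complete (map row v) (TernaryColumns⇒bounded v columns)))
    where
    columns : TernaryColumns v
    columns = ternaryColumns (admissible⇒3≤s/4 adm) v²≡α

proposition3p6 : (s : ℕ) → Admissible s →
    Arith.PythagorasAtLeast s 6 × Arith.HasLength s (Arith.α s) 6
proposition3p6 s adm =
  (Arith.α s , (6 , α-sum-of-six-squares s) , α-not-sum-of-fewer-squares s adm) ,
  (α-sum-of-six-squares s , α-not-sum-of-fewer-squares s adm)
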